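{- Let $G$ be a finite $2$-connected graph of maximum degree at most $3$. If $G$ contains two edge-disjoint odd cycles, then $G$ contains a skewed theta.
   Context: A skewed theta in $G$ is a (not necessarily induced) subgraph of $G$ which is the union of three edge-disjoint paths linking two vertices (the branch vertices), such that two of the paths have odd length and one has even length (length = number of edges). -}

module Defs where

open import Data.Nat using (ℕ; _≤_; _%_; _∸_)
open import Data.Fin using (Fin)
open import Data.Bool using (Bool; true; false)
open import Data.List using (List; []; _∷_; _++_; length; head; last; take; filterᵇ; allFin)
open import Data.List.Relation.Unary.Linked using (Linked)
open import Data.List.Relation.Unary.Unique.Propositional using (Unique)
open import Data.List.Membership.Propositional using (_∉_)
open import Data.Maybe using (just)
open import Data.Product using (_×_; ∃; ∃-syntax)
open import Data.Sum using (_⊎_)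
open import Relation.Binary.PropositionalEquality using (_≡_; _≢_)
open import Relation.Nullary using (¬_)

record Graph (n : ℕ) : Set where
  field
    adj   : Fin n → Fin n → Bool
    sym   : ∀ u v → adj u v ≡ adj v u
    irref : ∀ v → adj v v ≡ false

open Graph public

module _ {n : ℕ} (G : Graph n) where

  Adj : Fin n → Fin n → Set
  Adj u v = adj G u v ≡ true

  degree : Fin n → ℕ
  degree v = length (filterᵇ (adj G v) (allFin n))

  MaxDegreeAtMost : ℕ → Set
  MaxDegreeAtMost k = ∀ v → degree v ≤ k

  IsPath : Fin n → Fin n → List (Fin n) → Set
  IsPath x y vs = Linked Adj vs × Unique vs × head vs ≡ just x × last vs ≡ just y

  -- vs is (the cyclic vertex sequence of) a cycle in G:
  -- at least 3 distinct vertices, consecutive ones adjacent, last adjacent to first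
  IsCycle : List (Fin n) → Set
  IsCycle vs = 3 ≤ length vs × Unique vs × Linked Adj (vs ++ take 1 vs)

  Connected : Set
  Connected = ∀ u v → ∃[ vs ] IsPath u v vs

  ConnectedWithout : Fin n → Set
  ConnectedWithout w = ∀ u v → u ≢ w → v ≢ w → ∃[ vs ] (IsPath u v vs × w ∉ vs)

  -- 2-connected (Diestel): more than 2 vertices, and G - X connected for |X| < 2
  TwoConnected : Set
  TwoConnected = 3 ≤ n × Connected × (∀ w → ConnectedWithout w)

data Consecutive {n : ℕ} : List (Fin n) → Fin n → Fin n → Set where
  here  : ∀ {x y xs} → Consecutive (x ∷ y ∷ xs) x y
  there : ∀ {x xs u v} → Consecutive xs u v → Consecutive (x ∷ xs) u v

UsesEdge : {n : ℕ} → List (Fin n) → Fin n → Fin n → Set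
UsesEdge vs u v = Consecutive vs u v ⊎ Consecutive vs v u

PathEdge : {n : ℕ} → List (Fin n) → Fin n → Fin n → Set
PathEdge vs = UsesEdge vs

CycleEdge : {n : ℕ} → List (Fin n) → Fin n → Fin n → Set
CycleEdge vs = UsesEdge (vs ++ take 1 vs)

DisjointEdges : {n : ℕ} → (Fin n → Fin n → Set) → (Fin n → Fin n → Set) → Set
DisjointEdges {n} E F = ∀ (u v : Fin n) → E u v → ¬ F u v

pathLength : {n : ℕ} → List (Fin n) → ℕ
pathLength vs = length vs ∸ 1

cycleLength : {n : ℕ} → List (Fin n) → ℕ
cycleLength vs = length vs

Odd Even : ℕ → Set
Odd k = k % 2 ≡ 1
Even k = k % 2 ≡ 0

module _ {n : ℕ} (G : Graph n) where

  HasTwoEdgeDisjointOddCycles : Set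
  HasTwoEdgeDisjointOddCycles =
    ∃[ C ] ∃[ D ] (IsCycle G C × IsCycle G D × Odd (cycleLength C) × Odd (cycleLength D)
                   × DisjointEdges (CycleEdge C) (CycleEdge D))

  HasSkewedTheta : Set
  HasSkewedTheta =
    ∃[ x ] ∃[ y ] ∃[ P ] ∃[ Q ] ∃[ R ]
      ( x ≢ y
      × IsPath G x y P × IsPath G x y Q × IsPath G x y R
      × DisjointEdges (PathEdge P) (PathEdge Q)
      × DisjointEdges (PathEdge P) (PathEdge R)
      × DisjointEdges (PathEdge Q) (PathEdge R)
      × Odd (pathLength P) × Odd (pathLength Q) × Even (pathLength R))

-- Edge-disjoint cycles in a subcubic graph are vertex-disjoint, and a vertex of a cycle has at most
-- one neighbour off it. Take the odd cycles C, D and a C–D path P from c₁ to d₁. By 2-connectedness a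
-- path Q leaves C at some c₂ ≠ c₁ avoiding c₁; stop it at its first vertex z on P ∪ D. By the degree
-- bound z ≠ d₁. If z ∈ D, then P, an arc of D of suitable parity and Q form an odd ear of C from c₁
-- to c₂; if z ∈ P, the part of P up to z followed by Q is an ear of C. An odd ear of length at least 2,
-- with the odd and the even arc of C between its ends, is a skewed theta. An even ear closes up with
-- the odd arc of C to an odd cycle C′, which the rest of P joins to D by a shorter path: induct on
-- the length of P.
module Submission where

open import Defs hiding (sym)
open import Data.Nat using (ℕ; suc; _+_; _≤_; _<_; z≤n; s≤s; parity)
open import Data.Nat.Properties using (+-comm; +-suc; ≤-trans; +-mono-≤; +-monoˡ-≤; m≤m+n; <-irrefl)
open import Data.Nat.Induction using (<-wellFounded)
open import Data.Parity.Base using (Parity; 0ℙ; 1ℙ; _⁻¹) renaming (_+_ to _+ℙ_)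
open import Data.Parity.Properties using (+-homo-+)
open import Data.Fin using (Fin) renaming (_≟_ to _≟ᶠ_)
open import Data.Bool using (T)
open import Data.Unit using (tt)
open import Data.List using (List; []; _∷_; _++_; length; head; last; filterᵇ; allFin)
open import Data.List.Properties using (length-++; ∷-injectiveʳ)
open import Data.List.Relation.Unary.Linked using (Linked; [-]; _∷_)
open import Data.List.Relation.Unary.Unique.Propositional using (Unique; []; _∷_)
open import Data.List.Relation.Unary.Unique.Propositional.Properties using (Unique[x∷xs]⇒x∉xs) renaming (++⁺ to Unique-++⁺)
open import Data.List.Relation.Unary.All.Properties using (¬Any⇒All¬)
open import Data.List.Relation.Unary.Any using (Any; here; there; any?)
open import Data.List.Relation.Binary.Disjoint.Propositional using (Disjoint)
open import Data.List.Membership.Propositional using (_∈_; _∉_; lose)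
open import Data.List.Membership.Propositional.Properties using (∈-++⁺ˡ; ∈-++⁺ʳ; ∈-++⁻; ∈-∃++; ∈-filter⁺; ∈-allFin)
open import Data.List.Relation.Binary.Subset.Propositional using (_⊆_)
open import Relation.Nullary.Decidable.Core using (T?)
open import Data.Maybe using (just)
open import Data.Product using (Σ; _×_; _,_; proj₁; proj₂; swap; map; uncurry)
open import Data.Sum using (_⊎_; inj₁; inj₂; [_,_]′; map₁; map₂)
open import Data.Empty using (⊥; ⊥-elim)
open import Function using (_∘_)
open import Induction.WellFounded using (Acc; acc)
open import Relation.Binary.PropositionalEquality using (_≡_; _≢_; refl; sym; trans; cong; cong₂; subst; module ≡-Reasoning)
open import Relation.Nullary using (yes; no)

module _ {A : Set} where

  ∉⇒Unique-∷ : ∀ {x : A} {xs} → x ∉ xs → Unique xs → Unique (x ∷ xs)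
  ∉⇒Unique-∷ x∉xs u = ¬Any⇒All¬ _ x∉xs ∷ u

  Unique-tail : ∀ {x : A} {xs} → Unique (x ∷ xs) → Unique xs
  Unique-tail (_ ∷ u) = u

  Unique-++⁻ : ∀ (xs : List A) {ys} → Unique (xs ++ ys) → Unique xs × Unique ys × Disjoint xs ys
  Unique-++⁻ [] u = [] , u , λ ()
  Unique-++⁻ (x ∷ xs) u with Unique-++⁻ xs (Unique-tail u)
  ... | uxs , uys , xs#ys =
    ∉⇒Unique-∷ (Unique[x∷xs]⇒x∉xs u ∘ ∈-++⁺ˡ) uxs , uys ,
    λ { (here refl , m) → Unique[x∷xs]⇒x∉xs u (∈-++⁺ʳ xs m) ; (there m₁ , m₂) → xs#ys (m₁ , m₂) }

  Unique-++-comm : ∀ (xs : List A) {ys} → Unique (xs ++ ys) → Unique (ys ++ xs)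
  Unique-++-comm xs u with Unique-++⁻ xs u
  ... | uxs , uys , xs#ys = Unique-++⁺ uys uxs (xs#ys ∘ swap)

  Unique⇒⊆⇒length≤ : ∀ (ys xs : List A) → Unique ys → ys ⊆ xs → length ys ≤ length xs
  Unique⇒⊆⇒length≤ [] xs _ _ = z≤n
  Unique⇒⊆⇒length≤ (y ∷ ys) xs u ys⊆xs with ∈-∃++ (ys⊆xs (here refl))
  ... | as , bs , refl = subst (suc (length ys) ≤_) (sym length-as-y-bs)
                           (s≤s (Unique⇒⊆⇒length≤ ys (as ++ bs) (Unique-tail u) ys⊆as++bs))
    where
    length-as-y-bs : length (as ++ y ∷ bs) ≡ suc (length (as ++ bs))
    length-as-y-bs = trans (length-++ as) (trans (+-suc (length as) (length bs)) (cong suc (sym (length-++ as))))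
    ys⊆as++bs : ys ⊆ as ++ bs
    ys⊆as++bs m with ∈-++⁻ as (ys⊆xs (there m))
    ... | inj₁ m₁ = ∈-++⁺ˡ m₁
    ... | inj₂ (here refl) = ⊥-elim (Unique[x∷xs]⇒x∉xs u m)
    ... | inj₂ (there m₂) = ∈-++⁺ʳ as m₂

  last-∷ʳ : ∀ (x : A) xs → last (xs ++ x ∷ []) ≡ just x
  last-∷ʳ x [] = refl
  last-∷ʳ x (y ∷ []) = refl
  last-∷ʳ x (y ∷ z ∷ zs) = last-∷ʳ x (z ∷ zs)

module _ {n : ℕ} where

  Consecutive⇒∈ : ∀ {xs : List (Fin n)} {a b} → Consecutive xs a b → a ∈ xs × b ∈ xs
  Consecutive⇒∈ here = here refl , there (here refl)
  Consecutive⇒∈ (there c) = map there there (Consecutive⇒∈ c)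

  UsesEdge⇒∈ : ∀ {xs : List (Fin n)} {a b} → UsesEdge xs a b → a ∈ xs × b ∈ xs
  UsesEdge⇒∈ = [ Consecutive⇒∈ , swap ∘ Consecutive⇒∈ ]′

  Unique⇒¬Consecutive-refl : ∀ {xs : List (Fin n)} {a} → Unique xs → Consecutive xs a a → ⊥
  Unique⇒¬Consecutive-refl u here = Unique[x∷xs]⇒x∉xs u (here refl)
  Unique⇒¬Consecutive-refl u (there c) = Unique⇒¬Consecutive-refl (Unique-tail u) c

  Unique⇒¬Consecutive-head : ∀ {h : Fin n} {t a} → Unique (h ∷ t) → Consecutive (h ∷ t) a h → ⊥
  Unique⇒¬Consecutive-head u here = Unique[x∷xs]⇒x∉xs u (here refl)
  Unique⇒¬Consecutive-head u (there c) = Unique[x∷xs]⇒x∉xs u (proj₂ (Consecutive⇒∈ c))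

-- These go through because suc (suc k) % 2 reduces to k % 2.
parity≡1ℙ⇒Odd : ∀ k → parity k ≡ 1ℙ → Odd k
parity≡1ℙ⇒Odd 1 _ = refl
parity≡1ℙ⇒Odd (suc (suc k)) = parity≡1ℙ⇒Odd k

parity≡0ℙ⇒Even : ∀ k → parity k ≡ 0ℙ → Even k
parity≡0ℙ⇒Even 0 _ = refl
parity≡0ℙ⇒Even (suc (suc k)) = parity≡0ℙ⇒Even k

Odd⇒parity≡1ℙ : ∀ k → Odd k → parity k ≡ 1ℙ
Odd⇒parity≡1ℙ 1 _ = refl
Odd⇒parity≡1ℙ (suc (suc k)) = Odd⇒parity≡1ℙ k

odd-completion : ∀ p q → p +ℙ ((p +ℙ q) ⁻¹ +ℙ q) ≡ 1ℙ
odd-completion 0ℙ 0ℙ = refl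
odd-completion 0ℙ 1ℙ = refl
odd-completion 1ℙ 0ℙ = refl
odd-completion 1ℙ 1ℙ = refl

+ℙ≡1ℙ : ∀ p q → p +ℙ q ≡ 1ℙ → (p ≡ 1ℙ × q ≡ 0ℙ) ⊎ (p ≡ 0ℙ × q ≡ 1ℙ)
+ℙ≡1ℙ 0ℙ 1ℙ _ = inj₂ (refl , refl)
+ℙ≡1ℙ 1ℙ 0ℙ _ = inj₁ (refl , refl)

module Walks {n : ℕ} (G : Graph n) where

  V : Set
  V = Fin n

  E : V → V → Set
  E = Adj G

  E-sym : ∀ {x y} → E x y → E y x
  E-sym {x} {y} e = trans (Graph.sym G y x) e

  E⇒≢ : ∀ {x y} → E x y → x ≢ y
  E⇒≢ {x} e refl with trans (sym e) (irref G x)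
  ... | ()

  data Walk : V → V → Set where
    [_] : (x : V) → Walk x x
    step : ∀ {x y z} → E x y → Walk y z → Walk x z

  arrivals : ∀ {x y} → Walk x y → List V
  arrivals [ x ] = []
  arrivals (step {y = y} e w) = y ∷ arrivals w

  verts : ∀ {x y} → Walk x y → List V
  verts {x} w = x ∷ arrivals w

  len : ∀ {x y} → Walk x y → ℕ
  len [ x ] = 0
  len (step e w) = suc (len w)

  infixr 5 _++ʷ_
  _++ʷ_ : ∀ {x y z} → Walk x y → Walk y z → Walk x z
  [ x ] ++ʷ q = q
  step e p ++ʷ q = step e (p ++ʷ q)

  reverse : ∀ {x y} → Walk x y → Walk y x
  reverse [ x ] = [ x ]
  reverse (step {x} e w) = reverse w ++ʷ step (E-sym e) [ x ]

  InternallyDisjoint : ∀ {x y} → Walk x y → Walk x y → Set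
  InternallyDisjoint {x} {y} p q = ∀ {v} → v ∈ verts p → v ∈ verts q → v ≡ x ⊎ v ≡ y

  InternallyDisjoint-sym : ∀ {x y} {p q : Walk x y} → InternallyDisjoint p q → InternallyDisjoint q p
  InternallyDisjoint-sym disj m₁ m₂ = disj m₂ m₁

  arrivals-++ʷ : ∀ {x y z} (p : Walk x y) (q : Walk y z) → arrivals (p ++ʷ q) ≡ arrivals p ++ arrivals q
  arrivals-++ʷ [ x ] q = refl
  arrivals-++ʷ (step e p) q = cong (_ ∷_) (arrivals-++ʷ p q)

  len-++ʷ : ∀ {x y z} (p : Walk x y) (q : Walk y z) → len (p ++ʷ q) ≡ len p + len q
  len-++ʷ [ x ] q = refl
  len-++ʷ (step e p) q = cong suc (len-++ʷ p q)

  length-arrivals : ∀ {x y} (w : Walk x y) → length (arrivals w) ≡ len w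
  length-arrivals [ x ] = refl
  length-arrivals (step e w) = cong suc (length-arrivals w)

  len-reverse : ∀ {x y} (w : Walk x y) → len (reverse w) ≡ len w
  len-reverse [ x ] = refl
  len-reverse (step e w) = trans (len-++ʷ (reverse w) _) (trans (cong (_+ 1) (len-reverse w)) (+-comm (len w) 1))

  len-pos : ∀ {x y} (w : Walk x y) → x ≢ y → 1 ≤ len w
  len-pos [ x ] x≢x = ⊥-elim (x≢x refl)
  len-pos (step e w) _ = s≤s z≤n

  end∈verts : ∀ {x y} (w : Walk x y) → y ∈ verts w
  end∈verts [ x ] = here refl
  end∈verts (step e w) = there (end∈verts w)

  end∈arrivals : ∀ {x y} (w : Walk x y) → x ≢ y → y ∈ arrivals w
  end∈arrivals [ x ] x≢x = ⊥-elim (x≢x refl)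
  end∈arrivals (step e w) _ = end∈verts w

  verts⊆arrivals : ∀ {x} (w : Walk x x) → 1 ≤ len w → verts w ⊆ arrivals w
  verts⊆arrivals (step e w) _ (here refl) = end∈verts w
  verts⊆arrivals (step e w) _ (there m) = m

  ∈-++ʷ⁻ : ∀ {x y z v} (p : Walk x y) (q : Walk y z) → v ∈ verts (p ++ʷ q) → v ∈ verts p ⊎ v ∈ verts q
  ∈-++ʷ⁻ [ x ] q m = inj₂ m
  ∈-++ʷ⁻ (step e p) q (here refl) = inj₁ (here refl)
  ∈-++ʷ⁻ (step e p) q (there m) = map₁ there (∈-++ʷ⁻ p q m)

  ∈-++ʷ⁺ˡ : ∀ {x y z} (p : Walk x y) (q : Walk y z) → verts p ⊆ verts (p ++ʷ q)
  ∈-++ʷ⁺ˡ [ x ] q (here refl) = here refl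
  ∈-++ʷ⁺ˡ (step e p) q (here refl) = here refl
  ∈-++ʷ⁺ˡ (step e p) q (there m) = there (∈-++ʷ⁺ˡ p q m)

  ∈-++ʷ⁺ʳ : ∀ {x y z} (p : Walk x y) (q : Walk y z) → verts q ⊆ verts (p ++ʷ q)
  ∈-++ʷ⁺ʳ [ x ] q m = m
  ∈-++ʷ⁺ʳ (step e p) q m = there (∈-++ʷ⁺ʳ p q m)

  ∈-reverse⁻ : ∀ {x y} (w : Walk x y) → verts (reverse w) ⊆ verts w
  ∈-reverse⁻ [ x ] m = m
  ∈-reverse⁻ (step e w) m with ∈-++ʷ⁻ (reverse w) _ m
  ... | inj₁ m′ = there (∈-reverse⁻ w m′)
  ... | inj₂ (here refl) = there (here refl)
  ... | inj₂ (there (here refl)) = here refl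

  ∈-reverse⁺ : ∀ {x y} (w : Walk x y) → verts w ⊆ verts (reverse w)
  ∈-reverse⁺ [ x ] m = m
  ∈-reverse⁺ (step e w) (here refl) = ∈-++ʷ⁺ʳ (reverse w) _ (there (here refl))
  ∈-reverse⁺ (step e w) (there m) = ∈-++ʷ⁺ˡ (reverse w) _ (∈-reverse⁺ w m)

  Unique-++ʷ⁺ : ∀ {x y z} (p : Walk x y) (q : Walk y z) → Unique (verts p) → Unique (verts q)
              → (∀ {v} → v ∈ verts p → v ∈ verts q → v ≡ y) → Unique (verts (p ++ʷ q))
  Unique-++ʷ⁺ [ x ] q _ uq _ = uq
  Unique-++ʷ⁺ (step e p) q up uq meet = ∉⇒Unique-∷ x∉ (Unique-++ʷ⁺ p q (Unique-tail up) uq (meet ∘ there))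
    where
    x∉ : _ ∉ verts (p ++ʷ q)
    x∉ m with ∈-++ʷ⁻ p q m
    ... | inj₁ mp = Unique[x∷xs]⇒x∉xs up mp
    ... | inj₂ mq = Unique[x∷xs]⇒x∉xs up (subst (_∈ verts p) (sym (meet (here refl) mq)) (end∈verts p))

  Unique-++ʷ⁻ : ∀ {x y z} (p : Walk x y) (q : Walk y z) → Unique (verts (p ++ʷ q))
              → Unique (verts p) × Unique (verts q) × (∀ {v} → v ∈ verts p → v ∈ verts q → v ≡ y)
  Unique-++ʷ⁻ [ x ] q u = ∉⇒Unique-∷ (λ ()) [] , u , λ { (here refl) _ → refl }
  Unique-++ʷ⁻ (step e p) q u with Unique-++ʷ⁻ p q (Unique-tail u)
  ... | up , uq , meet = ∉⇒Unique-∷ (Unique[x∷xs]⇒x∉xs u ∘ ∈-++ʷ⁺ˡ p q) up , uq ,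
        λ { (here refl) m → ⊥-elim (Unique[x∷xs]⇒x∉xs u (∈-++ʷ⁺ʳ p q m)) ; (there m₁) m₂ → meet m₁ m₂ }

  Unique-reverse : ∀ {x y} (w : Walk x y) → Unique (verts w) → Unique (verts (reverse w))
  Unique-reverse [ x ] u = u
  Unique-reverse (step {x} e w) u =
    Unique-++ʷ⁺ (reverse w) (step (E-sym e) [ x ]) (Unique-reverse w (Unique-tail u))
      (∉⇒Unique-∷ (λ { (here refl) → Unique[x∷xs]⇒x∉xs u (here refl) }) (∉⇒Unique-∷ (λ ()) []))
      (λ { m (here refl) → refl ; m (there (here refl)) → ⊥-elim (Unique[x∷xs]⇒x∉xs u (∈-reverse⁻ w m)) })

  Unique⇒closed-len≡0 : ∀ {x} (w : Walk x x) → Unique (verts w) → len w ≡ 0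
  Unique⇒closed-len≡0 [ x ] _ = refl
  Unique⇒closed-len≡0 (step e w) u = ⊥-elim (Unique[x∷xs]⇒x∉xs u (end∈verts w))

  splitAt : ∀ {x y v} (w : Walk x y) → v ∈ verts w → Σ (Walk x v) λ p → Σ (Walk v y) λ q → w ≡ p ++ʷ q
  splitAt w (here refl) = [ _ ] , w , refl
  splitAt (step e w) (there m) with splitAt w m
  ... | p , q , refl = step e p , q , refl

  lastEdge : ∀ {x y} (w : Walk x y) → 1 ≤ len w
           → Σ V λ a → Σ (Walk x a) λ p → Σ (E a y) λ e → w ≡ p ++ʷ step e [ y ]
  lastEdge (step e [ y ]) _ = _ , [ _ ] , e , refl
  lastEdge (step e (step e′ w)) _ with lastEdge (step e′ w) (s≤s z≤n)
  ... | a , p , e″ , eq = a , step e p , e″ , cong (step e) eq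

  penultimate : ∀ {x y} (w : Walk x y) → x ≢ y → Σ V λ a → a ∈ verts w × E a y
  penultimate w x≢y with lastEdge w (len-pos w x≢y)
  ... | a , p , e , refl = a , ∈-++ʷ⁺ˡ p (step e [ _ ]) (end∈verts p) , e

  Consecutive-++ʷ⁻ : ∀ {x y z a b} (p : Walk x y) (q : Walk y z) → Consecutive (verts (p ++ʷ q)) a b
                   → Consecutive (verts p) a b ⊎ Consecutive (verts q) a b
  Consecutive-++ʷ⁻ [ x ] q c = inj₂ c
  Consecutive-++ʷ⁻ (step e p) q here = inj₁ here
  Consecutive-++ʷ⁻ (step e p) q (there c) = map₁ there (Consecutive-++ʷ⁻ p q c)

  Consecutive-++ʷ⁺ˡ : ∀ {x y z a b} (p : Walk x y) (q : Walk y z)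
                    → Consecutive (verts p) a b → Consecutive (verts (p ++ʷ q)) a b
  Consecutive-++ʷ⁺ˡ [ x ] q (there ())
  Consecutive-++ʷ⁺ˡ (step e p) q here = here
  Consecutive-++ʷ⁺ˡ (step e p) q (there c) = there (Consecutive-++ʷ⁺ˡ p q c)

  Consecutive-++ʷ⁺ʳ : ∀ {x y z a b} (p : Walk x y) (q : Walk y z)
                    → Consecutive (verts q) a b → Consecutive (verts (p ++ʷ q)) a b
  Consecutive-++ʷ⁺ʳ [ x ] q c = c
  Consecutive-++ʷ⁺ʳ (step e p) q c = there (Consecutive-++ʷ⁺ʳ p q c)

  Linked-verts : ∀ {x y} (w : Walk x y) → Linked E (verts w)
  Linked-verts [ x ] = [-]
  Linked-verts (step e w) = e ∷ Linked-verts w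

  last-verts : ∀ {x y} (w : Walk x y) → last (verts w) ≡ just y
  last-verts [ x ] = refl
  last-verts (step e w) = last-verts w

  fromLinked : ∀ {x y} (vs : List V) → Linked E vs → head vs ≡ just x → last vs ≡ just y
             → Σ (Walk x y) λ w → verts w ≡ vs
  fromLinked (v ∷ []) _ refl refl = [ v ] , refl
  fromLinked (v ∷ u ∷ vs) (e ∷ l) refl l≡y with fromLinked (u ∷ vs) l refl l≡y
  ... | w , eq = step e w , cong (v ∷_) eq

  fromIsPath : ∀ {x y vs} → IsPath G x y vs → Σ (Walk x y) λ w → Unique (verts w) × verts w ≡ vs
  fromIsPath {vs = vs} (linked , unique , hd , lst) with fromLinked vs linked hd lst
  ... | w , refl = w , unique , refl

module Degree {n : ℕ} (G : Graph n) (deg≤3 : MaxDegreeAtMost G 3) where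
  open Walks G

  no-four-neighbours : ∀ {v a b c d} → E v a → E v b → E v c → E v d
                     → a ≢ b → a ≢ c → a ≢ d → b ≢ c → b ≢ d → c ≢ d → ⊥
  no-four-neighbours {v} {a} {b} {c} {d} ea eb ec ed a≢b a≢c a≢d b≢c b≢d c≢d =
    <-irrefl refl (≤-trans 4≤deg (deg≤3 v))
    where
    neighbour : ∀ {x} → E v x → x ∈ filterᵇ (adj G v) (allFin n)
    neighbour {x} e = ∈-filter⁺ (T? ∘ adj G v) (∈-allFin x) (subst T (sym e) tt)
    distinct : Unique (a ∷ b ∷ c ∷ d ∷ [])
    distinct = ∉⇒Unique-∷ (λ { (here refl) → a≢b refl ; (there (here refl)) → a≢c refl
                             ; (there (there (here refl))) → a≢d refl })
              (∉⇒Unique-∷ (λ { (here refl) → b≢c refl ; (there (here refl)) → b≢d refl })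
              (∉⇒Unique-∷ (λ { (here refl) → c≢d refl }) (∉⇒Unique-∷ (λ ()) [])))
    4≤deg : 4 ≤ degree G v
    4≤deg = Unique⇒⊆⇒length≤ _ _ distinct
      λ { (here refl) → neighbour ea ; (there (here refl)) → neighbour eb
        ; (there (there (here refl))) → neighbour ec ; (there (there (there (here refl)))) → neighbour ed }

module Thetas {n : ℕ} (G : Graph n) where
  open Walks G

  Consecutive-ends⇒len≡1 : ∀ {x y} (q : Walk x y) → Unique (verts q) → Consecutive (verts q) x y → len q ≡ 1
  Consecutive-ends⇒len≡1 [ x ] _ (there ())
  Consecutive-ends⇒len≡1 (step e w) u here = cong suc (Unique⇒closed-len≡0 w (Unique-tail u))
  Consecutive-ends⇒len≡1 (step e w) u (there c) = ⊥-elim (Unique[x∷xs]⇒x∉xs u (proj₁ (Consecutive⇒∈ c)))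

  -- A shared edge would join two common vertices, i.e. the two ends; in q that is impossible unless q is that edge.
  InternallyDisjoint⇒DisjointEdges : ∀ {x y} (p q : Walk x y) → Unique (verts p) → Unique (verts q)
    → InternallyDisjoint p q → 2 ≤ len q → DisjointEdges (PathEdge (verts p)) (PathEdge (verts q))
  InternallyDisjoint⇒DisjointEdges {x} {y} p q up uq disj 2≤len u v uv∈p uv∈q
    with UsesEdge⇒∈ uv∈p | UsesEdge⇒∈ uv∈q
  ... | u∈p , v∈p | u∈q , v∈q =
    [ noEdge (disj u∈p u∈q) (disj v∈p v∈q) , noEdge (disj v∈p v∈q) (disj u∈p u∈q) ]′ uv∈q
    where
    noEdge : ∀ {a b} → a ≡ x ⊎ a ≡ y → b ≡ x ⊎ b ≡ y → Consecutive (verts q) a b → ⊥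
    noEdge (inj₁ refl) (inj₁ refl) c = Unique⇒¬Consecutive-refl uq c
    noEdge (inj₁ refl) (inj₂ refl) c = <-irrefl (sym (Consecutive-ends⇒len≡1 q uq c)) 2≤len
    noEdge (inj₂ refl) (inj₁ refl) c = Unique⇒¬Consecutive-head uq c
    noEdge (inj₂ refl) (inj₂ refl) c = Unique⇒¬Consecutive-refl uq c

  even⇒2≤len : ∀ {x y} (w : Walk x y) → x ≢ y → parity (len w) ≡ 0ℙ → 2 ≤ len w
  even⇒2≤len [ x ] x≢x _ = ⊥-elim (x≢x refl)
  even⇒2≤len (step e [ y ]) _ ()
  even⇒2≤len (step e (step e′ w)) _ _ = s≤s (s≤s z≤n)

  skewedTheta : ∀ {x y} → x ≢ y → (P Q R : Walk x y) → Unique (verts P) → Unique (verts Q) → Unique (verts R)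
    → InternallyDisjoint P Q → InternallyDisjoint P R → InternallyDisjoint Q R → 2 ≤ len Q
    → parity (len P) ≡ 1ℙ → parity (len Q) ≡ 1ℙ → parity (len R) ≡ 0ℙ → HasSkewedTheta G
  skewedTheta {x} {y} x≢y P Q R uP uQ uR P∣Q P∣R Q∣R 2≤Q oddP oddQ evenR =
    x , y , verts P , verts Q , verts R , x≢y , isPath P uP , isPath Q uQ , isPath R uR ,
    InternallyDisjoint⇒DisjointEdges P Q uP uQ P∣Q 2≤Q ,
    InternallyDisjoint⇒DisjointEdges P R uP uR P∣R 2≤R ,
    InternallyDisjoint⇒DisjointEdges Q R uQ uR Q∣R 2≤R ,
    parity≡1ℙ⇒Odd (length (arrivals P)) (trans (cong parity (length-arrivals P)) oddP) ,
    parity≡1ℙ⇒Odd (length (arrivals Q)) (trans (cong parity (length-arrivals Q)) oddQ) ,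
    parity≡0ℙ⇒Even (length (arrivals R)) (trans (cong parity (length-arrivals R)) evenR)
    where
    2≤R : 2 ≤ len R
    2≤R = even⇒2≤len R x≢y evenR
    isPath : (w : Walk x y) → Unique (verts w) → IsPath G x y (verts w)
    isPath w u = Linked-verts w , u , refl , last-verts w

module Bridges {n : ℕ} (G : Graph n) where
  open Walks G
  open import Data.List.Membership.DecPropositional (_≟ᶠ_ {n}) using (_∈?_)

  MeetsOnlyAt : ∀ {x y} → Walk x y → List V → V → Set
  MeetsOnlyAt w X a = ∀ {v} → v ∈ verts w → v ∈ X → v ≡ a

  -- An X–Y path in the sense of Diestel.
  record Bridge (X Y : List V) : Set where
    field
      {start end} : V
      walk : Walk start end
      unique : Unique (verts walk)
      start∈X : start ∈ X
      end∈Y : end ∈ Y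
      meets-X-only-at-start : MeetsOnlyAt walk X start
      meets-Y-only-at-end : MeetsOnlyAt walk Y end

  splitAtFirst : ∀ {x y} (Y : List V) (w : Walk x y) → y ∈ Y
    → Σ V λ b → Σ (Walk x b) λ p → Σ (Walk b y) λ q → w ≡ p ++ʷ q × b ∈ Y × MeetsOnlyAt p Y b
  splitAtFirst Y [ x ] x∈Y = x , [ x ] , [ x ] , refl , x∈Y , λ { (here refl) _ → refl }
  splitAtFirst Y (step {x} e w) y∈Y with x ∈? Y
  ... | yes x∈Y = x , [ x ] , step e w , refl , x∈Y , λ { (here refl) _ → refl }
  ... | no x∉Y with splitAtFirst Y w y∈Y
  ...   | b , p , q , refl , b∈Y , only = b , step e p , q , refl , b∈Y ,
          λ { (here refl) x∈Y → ⊥-elim (x∉Y x∈Y) ; (there m) → only m }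

  splitAtLast : ∀ {x y} (X : List V) (w : Walk x y) → Any (_∈ X) (verts w)
    → Σ V λ a → Σ (Walk x a) λ p → Σ (Walk a y) λ q → w ≡ p ++ʷ q × a ∈ X × MeetsOnlyAt q X a
  splitAtLast X [ x ] (here x∈X) = x , [ x ] , [ x ] , refl , x∈X , λ { (here refl) _ → refl }
  splitAtLast X (step {x} e w) hits with any? (_∈? X) (verts w)
  ... | yes hits′ with splitAtLast X w hits′
  ...   | a , p , q , refl , a∈X , only = a , step e p , q , refl , a∈X , only
  splitAtLast X (step {x} e w) (here x∈X) | no misses =
    x , [ x ] , step e w , refl , x∈X , λ { (here refl) _ → refl ; (there m) v∈X → ⊥-elim (misses (lose m v∈X)) }
  splitAtLast X (step {x} e w) (there hits′) | no misses = ⊥-elim (misses hits′)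

  bridge : ∀ {x y} (X Y : List V) (w : Walk x y) → Unique (verts w) → x ∈ X → y ∈ Y
         → Σ (Bridge X Y) λ B → verts (Bridge.walk B) ⊆ verts w
  bridge X Y w uw x∈X y∈Y with splitAtFirst Y w y∈Y
  ... | b , p , q , refl , b∈Y , p-only with splitAtLast X p (here x∈X)
  ...   | a , p₁ , p₂ , refl , a∈X , p₂-only = B , ∈-++ʷ⁺ˡ (p₁ ++ʷ p₂) q ∘ ∈-++ʷ⁺ʳ p₁ p₂
    where
    B : Bridge X Y
    B = record
      { walk = p₂
      ; unique = proj₁ (proj₂ (Unique-++ʷ⁻ p₁ p₂ (proj₁ (Unique-++ʷ⁻ (p₁ ++ʷ p₂) q uw))))
      ; start∈X = a∈X
      ; end∈Y = b∈Y
      ; meets-X-only-at-start = p₂-only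
      ; meets-Y-only-at-end = p-only ∘ ∈-++ʷ⁺ʳ p₁ p₂
      }

  bridgeOf : Connected G → ∀ {a b} (X Y : List V) → a ∈ X → b ∈ Y → Bridge X Y
  bridgeOf conn X Y a∈X b∈Y with conn _ _
  ... | vs , isPath with fromIsPath isPath
  ...   | w , uw , refl = proj₁ (bridge X Y w uw a∈X b∈Y)

  bridgeAvoiding : ∀ {c} → ConnectedWithout G c → ∀ {a b} (X Y : List V) → a ∈ X → b ∈ Y → a ≢ c → b ≢ c
                 → Σ (Bridge X Y) λ B → c ∉ verts (Bridge.walk B)
  bridgeAvoiding conn X Y a∈X b∈Y a≢c b≢c with conn _ _ a≢c b≢c
  ... | vs , isPath , c∉vs with fromIsPath isPath
  ...   | w , uw , refl with bridge X Y w uw a∈X b∈Y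
  ...     | B , B⊆w = B , c∉vs ∘ B⊆w

module Cycles {n : ℕ} (G : Graph n) where
  open Walks G

  record Cycle : Set where
    field
      {root} : V
      walk : Walk root root
      unique : Unique (arrivals walk)
      3≤len : 3 ≤ len walk

  vertices : Cycle → List V
  vertices C = arrivals (Cycle.walk C)

  lengthᶜ : Cycle → ℕ
  lengthᶜ C = len (Cycle.walk C)

  OddCycle : Cycle → Set
  OddCycle C = parity (lengthᶜ C) ≡ 1ℙ

  ∈-arrivals-++ʷ⁻ : ∀ {x y z v} (p : Walk x y) (q : Walk y z)
                  → v ∈ arrivals (p ++ʷ q) → v ∈ arrivals p ⊎ v ∈ arrivals q
  ∈-arrivals-++ʷ⁻ p q m = ∈-++⁻ (arrivals p) (subst (_ ∈_) (arrivals-++ʷ p q) m)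

  ∈-arrivals-++ʷ⁺ˡ : ∀ {x y z} (p : Walk x y) (q : Walk y z) → arrivals p ⊆ arrivals (p ++ʷ q)
  ∈-arrivals-++ʷ⁺ˡ p q m = subst (_ ∈_) (sym (arrivals-++ʷ p q)) (∈-++⁺ˡ m)

  ∈-arrivals-++ʷ⁺ʳ : ∀ {x y z} (p : Walk x y) (q : Walk y z) → arrivals q ⊆ arrivals (p ++ʷ q)
  ∈-arrivals-++ʷ⁺ʳ p q m = subst (_ ∈_) (sym (arrivals-++ʷ p q)) (∈-++⁺ʳ (arrivals p) m)

  record Rotation {r} (c : Walk r r) (a : V) : Set where
    field
      walk : Walk a a
      unique : Unique (arrivals walk)
      len-≡ : len walk ≡ len c
      ⊆-original : arrivals walk ⊆ arrivals c
      ⊇-original : arrivals c ⊆ arrivals walk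
      edges-⊆ : ∀ {u v} → Consecutive (verts walk) u v → Consecutive (verts c) u v

  rotate : ∀ {r a} (c : Walk r r) → Unique (arrivals c) → a ∈ arrivals c → Rotation c a
  rotate c u a∈c with splitAt c (there a∈c)
  ... | p , q , refl = record
    { walk = q ++ʷ p
    ; unique = subst Unique (sym (arrivals-++ʷ q p)) (Unique-++-comm (arrivals p) (subst Unique (arrivals-++ʷ p q) u))
    ; len-≡ = trans (len-++ʷ q p) (trans (+-comm (len q) (len p)) (sym (len-++ʷ p q)))
    ; ⊆-original = [ ∈-arrivals-++ʷ⁺ʳ p q , ∈-arrivals-++ʷ⁺ˡ p q ]′ ∘ ∈-arrivals-++ʷ⁻ q p
    ; ⊇-original = [ ∈-arrivals-++ʷ⁺ʳ q p , ∈-arrivals-++ʷ⁺ˡ q p ]′ ∘ ∈-arrivals-++ʷ⁻ p q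
    ; edges-⊆ = [ Consecutive-++ʷ⁺ʳ p q , Consecutive-++ʷ⁺ˡ p q ]′ ∘ Consecutive-++ʷ⁻ q p
    }

  record Arcs (C : Cycle) (a b : V) : Set where
    field
      first second : Walk a b
      first-unique : Unique (verts first)
      second-unique : Unique (verts second)
      first-⊆ : verts first ⊆ vertices C
      second-⊆ : verts second ⊆ vertices C
      disjoint : InternallyDisjoint first second
      len-+ : len first + len second ≡ lengthᶜ C

  arcs : ∀ {a b} (C : Cycle) → a ∈ vertices C → b ∈ vertices C → a ≢ b → Arcs C a b
  arcs {a} {b} C a∈C b∈C a≢b with rotate (Cycle.walk C) (Cycle.unique C) a∈C
  ... | ρ with splitAt (Rotation.walk ρ) (there (Rotation.⊇-original ρ b∈C))
  ...   | p , q , c≡p++q = record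
    { first = p
    ; second = reverse q
    ; first-unique = ∉⇒Unique-∷ (λ m → p#q (m , end∈arrivals q (a≢b ∘ sym))) up
    ; second-unique = Unique-reverse q (∉⇒Unique-∷ (λ m → p#q (end∈arrivals p a≢b , m)) uq)
    ; first-⊆ = λ { (here refl) → a∈C ; (there m) → on-C (∈-arrivals-++ʷ⁺ˡ p q m) }
    ; second-⊆ = q-⊆ ∘ ∈-reverse⁻ q
    ; disjoint = λ { (here refl) _ → inj₁ refl ; (there m₁) m₂ → meet m₁ (∈-reverse⁻ q m₂) }
    ; len-+ = trans (cong (len p +_) (len-reverse q)) (trans (sym (len-++ʷ p q)) len-c)
    }
    where
    on-C : arrivals (p ++ʷ q) ⊆ vertices C
    on-C = Rotation.⊆-original ρ ∘ subst (λ w → _ ∈ arrivals w) (sym c≡p++q)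
    len-c : len (p ++ʷ q) ≡ lengthᶜ C
    len-c = trans (cong len (sym c≡p++q)) (Rotation.len-≡ ρ)
    split-unique : Unique (arrivals p) × Unique (arrivals q) × Disjoint (arrivals p) (arrivals q)
    split-unique = Unique-++⁻ (arrivals p) (subst Unique (trans (cong arrivals c≡p++q) (arrivals-++ʷ p q)) (Rotation.unique ρ))
    up = proj₁ split-unique
    uq = proj₁ (proj₂ split-unique)
    p#q = proj₂ (proj₂ split-unique)
    q-⊆ : verts q ⊆ vertices C
    q-⊆ (here refl) = b∈C
    q-⊆ (there m) = on-C (∈-arrivals-++ʷ⁺ʳ p q m)
    meet : ∀ {v} → v ∈ arrivals p → v ∈ verts q → v ≡ a ⊎ v ≡ b
    meet _ (here refl) = inj₂ refl
    meet m₁ (there m₂) = ⊥-elim (p#q (m₁ , m₂))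

  Arcs-swap : ∀ {C a b} → Arcs C a b → Arcs C a b
  Arcs-swap A = record
    { first = second ; second = first ; first-unique = second-unique ; second-unique = first-unique
    ; first-⊆ = second-⊆ ; second-⊆ = first-⊆ ; disjoint = InternallyDisjoint-sym disjoint
    ; len-+ = trans (+-comm (len second) (len first)) len-+ }
    where open Arcs A

  oddEvenArcs : ∀ {a b} (C : Cycle) → OddCycle C → a ∈ vertices C → b ∈ vertices C → a ≢ b
              → Σ (Arcs C a b) λ A → parity (len (Arcs.first A)) ≡ 1ℙ × parity (len (Arcs.second A)) ≡ 0ℙ
  oddEvenArcs C odd a∈C b∈C a≢b with A ← arcs C a∈C b∈C a≢b
    with +ℙ≡1ℙ _ _ (trans (sym (+-homo-+ (len (Arcs.first A)) (len (Arcs.second A)))) (trans (cong parity (Arcs.len-+ A)) odd))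
  ... | inj₁ (odd₁ , even₂) = A , odd₁ , even₂
  ... | inj₂ (even₁ , odd₂) = Arcs-swap A , odd₂ , even₁

  arcOfParity : ∀ {a b} (C : Cycle) → OddCycle C → a ∈ vertices C → b ∈ vertices C → a ≢ b → (t : Parity)
              → Σ (Walk a b) λ B → Unique (verts B) × verts B ⊆ vertices C × parity (len B) ≡ t
  arcOfParity C odd a∈C b∈C a≢b t with oddEvenArcs C odd a∈C b∈C a≢b | t
  ... | A , odd₁ , _ | 1ℙ = Arcs.first A , Arcs.first-unique A , Arcs.first-⊆ A , odd₁
  ... | A , _ , even₂ | 0ℙ = Arcs.second A , Arcs.second-unique A , Arcs.second-⊆ A , even₂

  record Neighbours (C : Cycle) (v : V) : Set where
    field
      left right : V
      left≢right : left ≢ right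
      left-edge : E v left
      right-edge : E v right
      left∈C : left ∈ vertices C
      right∈C : right ∈ vertices C
      left-uses : UsesEdge (verts (Cycle.walk C)) v left
      right-uses : UsesEdge (verts (Cycle.walk C)) v right

  neighbours : ∀ {v} (C : Cycle) → v ∈ vertices C → Neighbours C v
  neighbours {v} C v∈C with rotate (Cycle.walk C) (Cycle.unique C) v∈C
  ... | ρ with Rotation.walk ρ | Rotation.unique ρ | Rotation.len-≡ ρ | Rotation.⊆-original ρ | Rotation.edges-⊆ ρ
  ...   | [ _ ] | _ | len≡ | _ | _ = ⊥-elim (3≰0 (subst (3 ≤_) (sym len≡) (Cycle.3≤len C)))
    where
    3≰0 : 3 ≤ 0 → ⊥
    3≰0 ()
  ...   | step {y = a} e w | uw | len≡ | ⊆C | edges⊆ with lastEdge w (len-pos w (E⇒≢ e ∘ sym))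
  ...     | b , w₀ , e′ , refl = record
    { left = a ; right = b ; left≢right = a≢b ; left-edge = e ; right-edge = E-sym e′
    ; left∈C = ⊆C (here refl) ; right∈C = ⊆C (∈-++ʷ⁺ʳ w₀ (step e′ [ v ]) (here refl))
    ; left-uses = inj₁ (edges⊆ here)
    ; right-uses = inj₂ (edges⊆ (there (Consecutive-++ʷ⁺ʳ w₀ (step e′ [ v ]) here))) }
    where
    -- a ≡ b would make w₀ a closed path, so the cycle would have length 2.
    a≢b : a ≢ b
    a≢b refl with Unique⇒closed-len≡0 w₀ (proj₁ (Unique-++ʷ⁻ w₀ (step e′ [ v ]) uw))
    ... | len₀≡0 = <-irrefl refl (subst (3 ≤_) length≡2 (Cycle.3≤len C))
      where
      length≡2 : lengthᶜ C ≡ 2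
      length≡2 = trans (sym len≡) (cong suc (trans (len-++ʷ w₀ (step e′ [ v ])) (cong (_+ 1) len₀≡0)))

  fromOddIsCycle : ∀ {vs} → IsCycle G vs → Odd (cycleLength vs)
    → Σ Cycle λ C → OddCycle C × (∀ {a b} → UsesEdge (verts (Cycle.walk C)) a b → CycleEdge vs a b)
  fromOddIsCycle {c ∷ cs} (3≤length , unique , linked) odd
    with fromLinked (c ∷ cs ++ c ∷ []) linked refl (last-∷ʳ c (c ∷ cs))
  ... | w , verts≡ = C , trans (cong parity len≡) (Odd⇒parity≡1ℙ (length (c ∷ cs)) odd) ,
                     λ {a} {b} → subst (λ vs → UsesEdge vs a b) verts≡
    where
    arrivals≡ : arrivals w ≡ cs ++ c ∷ []
    arrivals≡ = ∷-injectiveʳ verts≡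
    len≡ : len w ≡ length (c ∷ cs)
    len≡ = trans (sym (length-arrivals w)) (trans (cong length arrivals≡) (trans (length-++ cs) (+-comm (length cs) 1)))
    C : Cycle
    C = record
      { walk = w
      ; unique = subst Unique (sym arrivals≡) (Unique-++-comm (c ∷ []) unique)
      ; 3≤len = subst (3 ≤_) (sym len≡) 3≤length }

  root∈vertices : (C : Cycle) → Cycle.root C ∈ vertices C
  root∈vertices C = verts⊆arrivals (Cycle.walk C) (≤-trans (s≤s z≤n) (Cycle.3≤len C)) (here refl)

  otherVertex : (C : Cycle) (a : V) → Σ V λ b → b ∈ vertices C × b ≢ a
  otherVertex record { walk = step {y = b} e (step {y = c} e′ w) ; unique = u } a with b ≟ᶠ a
  ... | yes refl = c , there (here refl) , λ c≡b → Unique[x∷xs]⇒x∉xs u (here (sym c≡b))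
  ... | no b≢a = b , here refl , b≢a
  otherVertex record { walk = step e [ _ ] ; 3≤len = s≤s () } a

  closeCycle : ∀ {a b} (p q : Walk a b) → Unique (verts p) → Unique (verts q) → InternallyDisjoint p q → a ≢ b
             → 3 ≤ len p + len q
             → Σ Cycle λ C → lengthᶜ C ≡ len p + len q
                           × (∀ {v} → v ∈ vertices C → v ∈ verts p ⊎ v ∈ verts q) × verts q ⊆ vertices C
  closeCycle {a} {b} p q up uq disj a≢b 3≤len = C , len≡ , ⊆p∪q , q⊆C
    where
    urq : Unique (verts (reverse q))
    urq = Unique-reverse q uq
    p#q : Disjoint (arrivals p) (arrivals (reverse q))
    p#q (m₁ , m₂) with disj (there m₁) (∈-reverse⁻ q (there m₂))
    ... | inj₁ refl = Unique[x∷xs]⇒x∉xs up m₁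
    ... | inj₂ refl = Unique[x∷xs]⇒x∉xs urq m₂
    len≡ : len (p ++ʷ reverse q) ≡ len p + len q
    len≡ = trans (len-++ʷ p (reverse q)) (cong (len p +_) (len-reverse q))
    C : Cycle
    C = record
      { walk = p ++ʷ reverse q
      ; unique = subst Unique (sym (arrivals-++ʷ p (reverse q))) (Unique-++⁺ (Unique-tail up) (Unique-tail urq) p#q)
      ; 3≤len = subst (3 ≤_) (sym len≡) 3≤len }
    ⊆p∪q : ∀ {v} → v ∈ vertices C → v ∈ verts p ⊎ v ∈ verts q
    ⊆p∪q m = map₂ (∈-reverse⁻ q) (∈-++ʷ⁻ p (reverse q) (there m))
    q⊆C : verts q ⊆ vertices C
    q⊆C = verts⊆arrivals (p ++ʷ reverse q) (≤-trans (s≤s z≤n) (Cycle.3≤len C))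
          ∘ ∈-++ʷ⁺ʳ p (reverse q) ∘ ∈-reverse⁺ q

module SubcubicCycles {n : ℕ} (G : Graph n) (deg≤3 : MaxDegreeAtMost G 3) where
  open Walks G
  open Cycles G
  open Degree G deg≤3

  outerNeighbour-unique : ∀ {v p q} (C : Cycle) → v ∈ vertices C → E v p → E v q
                        → p ∉ vertices C → q ∉ vertices C → p ≡ q
  outerNeighbour-unique {p = p} {q} C v∈C ep eq p∉C q∉C with p ≟ᶠ q
  ... | yes p≡q = p≡q
  ... | no p≢q = ⊥-elim (no-four-neighbours left-edge right-edge ep eq left≢right
                           (off left∈C p∉C) (off left∈C q∉C) (off right∈C p∉C) (off right∈C q∉C) p≢q)
    where
    open Neighbours (neighbours C v∈C)
    off : ∀ {x y} → x ∈ vertices C → y ∉ vertices C → x ≢ y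
    off x∈C y∉C refl = y∉C x∈C

  EdgeDisjoint : Cycle → Cycle → Set
  EdgeDisjoint C D = DisjointEdges (UsesEdge (verts (Cycle.walk C))) (UsesEdge (verts (Cycle.walk D)))

  -- A common vertex would have two cycle edges on each cycle, all four distinct.
  EdgeDisjoint⇒Disjoint : (C D : Cycle) → EdgeDisjoint C D → Disjoint (vertices C) (vertices D)
  EdgeDisjoint⇒Disjoint C D C#D {v} (v∈C , v∈D) =
    no-four-neighbours (left-edge NC) (right-edge NC) (left-edge ND) (right-edge ND) (left≢right NC)
      (different (left-uses NC) (left-uses ND)) (different (left-uses NC) (right-uses ND))
      (different (right-uses NC) (left-uses ND)) (different (right-uses NC) (right-uses ND)) (left≢right ND)
    where
    open Neighbours
    NC = neighbours C v∈C
    ND = neighbours D v∈D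
    different : ∀ {a b} → UsesEdge (verts (Cycle.walk C)) v a → UsesEdge (verts (Cycle.walk D)) v b → a ≢ b
    different va vb refl = C#D v _ va vb

module Ears {n : ℕ} (G : Graph n) where
  open Walks G
  open Cycles G
  open Thetas G

  record Ear (C : Cycle) (a b : V) : Set where
    field
      walk : Walk a b
      unique : Unique (verts walk)
      start∈C : a ∈ vertices C
      end∈C : b ∈ vertices C
      start≢end : a ≢ b
      meets-C-only-at-ends : ∀ {v} → v ∈ verts walk → v ∈ vertices C → v ≡ a ⊎ v ≡ b
      2≤len : 2 ≤ len walk

  module _ {a b} (C : Cycle) (C-odd : OddCycle C) (R : Ear C a b) where
    open Ear R

    private
      oddEven : Σ (Arcs C a b) λ A → parity (len (Arcs.first A)) ≡ 1ℙ × parity (len (Arcs.second A)) ≡ 0ℙ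
      oddEven = oddEvenArcs C C-odd start∈C end∈C start≢end

    open Arcs (proj₁ oddEven)

    first-meets-R : InternallyDisjoint first walk
    first-meets-R m₁ m₂ = meets-C-only-at-ends m₂ (first-⊆ m₁)

    oddEar⇒skewedTheta : parity (len walk) ≡ 1ℙ → HasSkewedTheta G
    oddEar⇒skewedTheta R-odd =
      skewedTheta start≢end first walk second first-unique unique second-unique
        first-meets-R disjoint (λ m₁ m₂ → meets-C-only-at-ends m₁ (second-⊆ m₂))
        2≤len (proj₁ (proj₂ oddEven)) R-odd (proj₂ (proj₂ oddEven))

    evenEar⇒oddCycle : parity (len walk) ≡ 0ℙ
      → Σ Cycle λ C′ → OddCycle C′ × (∀ {v} → v ∈ vertices C′ → v ∈ vertices C ⊎ v ∈ verts walk)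
                     × verts walk ⊆ vertices C′
    evenEar⇒oddCycle R-even with closeCycle first walk first-unique unique first-meets-R start≢end
                                   (+-mono-≤ (len-pos first start≢end) 2≤len)
    ... | C′ , len≡ , ⊆first∪R , R⊆C′ = C′ , C′-odd , map₁ first-⊆ ∘ ⊆first∪R , R⊆C′
      where
      C′-odd : OddCycle C′
      C′-odd = begin
        parity (lengthᶜ C′)                             ≡⟨ cong parity len≡ ⟩
        parity (len first + len walk)                   ≡⟨ +-homo-+ (len first) (len walk) ⟩
        parity (len first) +ℙ parity (len walk)         ≡⟨ cong₂ _+ℙ_ (proj₁ (proj₂ oddEven)) R-even ⟩
        1ℙ                                              ∎
        where open ≡-Reasoning

module Configurations {n : ℕ} (G : Graph n) (2-connected : TwoConnected G) (deg≤3 : MaxDegreeAtMost G 3) where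
  open Walks G
  open Cycles G
  open Bridges G
  open Ears G
  open SubcubicCycles G deg≤3
  open import Data.List.Membership.DecPropositional (_≟ᶠ_ {n}) using (_∈?_)

  record Configuration : Set where
    field
      C D : Cycle
      C-odd : OddCycle C
      D-odd : OddCycle D
      C#D : Disjoint (vertices C) (vertices D)
      P : Bridge (vertices C) (vertices D)

  bridgeLength : Configuration → ℕ
  bridgeLength K = len (Bridge.walk (Configuration.P K))

  module Step (K : Configuration) where
    open Configuration K
    module P = Bridge P

    c₁≢d₁ : P.start ≢ P.end
    c₁≢d₁ refl = C#D (P.start∈X , P.end∈Y)

    Y : List V
    Y = verts P.walk ++ vertices D

    opaque
      detour : Σ (Bridge (vertices C) Y) λ Q → P.start ∉ verts (Bridge.walk Q)
      detour with otherVertex C P.start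
      ... | c₂ , c₂∈C , c₂≢c₁ = bridgeAvoiding (proj₂ (proj₂ 2-connected) P.start) (vertices C) Y
                                  c₂∈C (∈-++⁺ʳ (verts P.walk) P.end∈Y) c₂≢c₁ (c₁≢d₁ ∘ sym)

    Q : Bridge (vertices C) Y
    Q = proj₁ detour
    module Q = Bridge Q

    c₁≢c₂ : P.start ≢ Q.start
    c₁≢c₂ c₁≡c₂ = proj₂ detour (subst (_∈ verts Q.walk) (sym c₁≡c₂) (here refl))

    z≢c₁ : Q.end ≢ P.start
    z≢c₁ z≡c₁ = proj₂ detour (subst (_∈ verts Q.walk) z≡c₁ (end∈verts Q.walk))

    z∉C : Q.end ∉ vertices C
    z∉C z∈C with ∈-++⁻ (verts P.walk) Q.end∈Y
    ... | inj₁ z∈P = z≢c₁ (P.meets-X-only-at-start z∈P z∈C)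
    ... | inj₂ z∈D = C#D (z∈C , z∈D)

    c₂≢z : Q.start ≢ Q.end
    c₂≢z c₂≡z = z∉C (subst (_∈ vertices C) c₂≡z Q.start∈X)

    -- d₁ would have two neighbours on D and two more off D, one on P and one on Q.
    z≢d₁ : Q.end ≢ P.end
    z≢d₁ z≡d₁ with penultimate P.walk c₁≢d₁ | penultimate Q.walk c₂≢z
    ... | p , p∈P , ep | q , q∈Q , eq = E⇒≢ eq (Q.meets-Y-only-at-end q∈Q (∈-++⁺ˡ q∈P))
      where
      p∉D : p ∉ vertices D
      p∉D p∈D = E⇒≢ ep (P.meets-Y-only-at-end p∈P p∈D)
      q∉D : q ∉ vertices D
      q∉D q∈D = E⇒≢ eq (Q.meets-Y-only-at-end q∈Q (∈-++⁺ʳ (verts P.walk) q∈D))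
      q∈P : q ∈ verts P.walk
      q∈P = subst (_∈ verts P.walk)
              (outerNeighbour-unique D P.end∈Y (E-sym ep) (subst (λ v → E v q) z≡d₁ (E-sym eq)) p∉D q∉D) p∈P

    oddEarThroughD : Q.end ∈ vertices D → Σ (Ear C P.start Q.start) λ R → parity (len (Ear.walk R)) ≡ 1ℙ
    oddEarThroughD z∈D
      with arcOfParity D D-odd P.end∈Y z∈D (z≢d₁ ∘ sym) ((parity (len P.walk) +ℙ parity (len Q.walk)) ⁻¹)
    ... | B , B-unique , B⊆D , B-parity = R , R-odd
      where
      BQ : Walk P.end Q.start
      BQ = B ++ʷ reverse Q.walk
      PBQ : Walk P.start Q.start
      PBQ = P.walk ++ʷ BQ
      B-meets-Q : ∀ {v} → v ∈ verts B → v ∈ verts (reverse Q.walk) → v ≡ Q.end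
      B-meets-Q m₁ m₂ = Q.meets-Y-only-at-end (∈-reverse⁻ Q.walk m₂) (∈-++⁺ʳ (verts P.walk) (B⊆D m₁))
      P-meets-BQ : ∀ {v} → v ∈ verts P.walk → v ∈ verts BQ → v ≡ P.end
      P-meets-BQ m₁ m₂ with ∈-++ʷ⁻ B (reverse Q.walk) m₂
      ... | inj₁ m = P.meets-Y-only-at-end m₁ (B⊆D m)
      ... | inj₂ m = P.meets-Y-only-at-end m₁
                       (subst (_∈ vertices D) (sym (Q.meets-Y-only-at-end (∈-reverse⁻ Q.walk m) (∈-++⁺ˡ m₁))) z∈D)
      meets-C : ∀ {v} → v ∈ verts PBQ → v ∈ vertices C → v ≡ P.start ⊎ v ≡ Q.start
      meets-C m v∈C with ∈-++ʷ⁻ P.walk BQ m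
      ... | inj₁ m′ = inj₁ (P.meets-X-only-at-start m′ v∈C)
      ... | inj₂ m′ with ∈-++ʷ⁻ B (reverse Q.walk) m′
      ...   | inj₁ m″ = ⊥-elim (C#D (v∈C , B⊆D m″))
      ...   | inj₂ m″ = inj₂ (Q.meets-X-only-at-start (∈-reverse⁻ Q.walk m″) v∈C)
      len≡ : len PBQ ≡ len P.walk + (len B + len Q.walk)
      len≡ = trans (len-++ʷ P.walk BQ) (cong (len P.walk +_) (trans (len-++ʷ B _) (cong (len B +_) (len-reverse Q.walk))))
      R : Ear C P.start Q.start
      R = record
        { walk = PBQ
        ; unique = Unique-++ʷ⁺ P.walk BQ P.unique
                     (Unique-++ʷ⁺ B (reverse Q.walk) B-unique (Unique-reverse Q.walk Q.unique) B-meets-Q) P-meets-BQ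
        ; start∈C = P.start∈X
        ; end∈C = Q.start∈X
        ; start≢end = c₁≢c₂
        ; meets-C-only-at-ends = meets-C
        ; 2≤len = subst (2 ≤_) (sym len≡)
                    (+-mono-≤ (len-pos P.walk c₁≢d₁) (≤-trans (len-pos B (z≢d₁ ∘ sym)) (m≤m+n (len B) (len Q.walk))))
        }
      R-odd : parity (len PBQ) ≡ 1ℙ
      R-odd = begin
        parity (len PBQ)                                          ≡⟨ cong parity len≡ ⟩
        parity (len P.walk + (len B + len Q.walk))                ≡⟨ +-homo-+ (len P.walk) _ ⟩
        parity (len P.walk) +ℙ parity (len B + len Q.walk)        ≡⟨ cong (parity (len P.walk) +ℙ_) (+-homo-+ (len B) _) ⟩
        parity (len P.walk) +ℙ (parity (len B) +ℙ parity (len Q.walk))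
          ≡⟨ cong (λ t → parity (len P.walk) +ℙ (t +ℙ parity (len Q.walk))) B-parity ⟩
        parity (len P.walk) +ℙ ((parity (len P.walk) +ℙ parity (len Q.walk)) ⁻¹ +ℙ parity (len Q.walk))
          ≡⟨ odd-completion (parity (len P.walk)) (parity (len Q.walk)) ⟩
        1ℙ                                                        ∎
        where open ≡-Reasoning

    module ThroughP (z∉D : Q.end ∉ vertices D) where
      z∈P : Q.end ∈ verts P.walk
      z∈P with ∈-++⁻ (verts P.walk) Q.end∈Y
      ... | inj₁ z∈P = z∈P
      ... | inj₂ z∈D = ⊥-elim (z∉D z∈D)

      P₁ : Walk P.start Q.end
      P₁ = proj₁ (splitAt P.walk z∈P)
      P₂ : Walk Q.end P.end
      P₂ = proj₁ (proj₂ (splitAt P.walk z∈P))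
      P≡P₁++P₂ : P.walk ≡ P₁ ++ʷ P₂
      P≡P₁++P₂ = proj₂ (proj₂ (splitAt P.walk z∈P))

      P₁⊆P : verts P₁ ⊆ verts P.walk
      P₁⊆P = subst (λ w → verts P₁ ⊆ verts w) (sym P≡P₁++P₂) (∈-++ʷ⁺ˡ P₁ P₂)
      P₂⊆P : verts P₂ ⊆ verts P.walk
      P₂⊆P = subst (λ w → verts P₂ ⊆ verts w) (sym P≡P₁++P₂) (∈-++ʷ⁺ʳ P₁ P₂)

      split-unique : Unique (verts P₁) × Unique (verts P₂) × (∀ {v} → v ∈ verts P₁ → v ∈ verts P₂ → v ≡ Q.end)
      split-unique = Unique-++ʷ⁻ P₁ P₂ (subst (Unique ∘ verts) P≡P₁++P₂ P.unique)
      P₁-meets-P₂ : ∀ {v} → v ∈ verts P₁ → v ∈ verts P₂ → v ≡ Q.end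
      P₁-meets-P₂ = proj₂ (proj₂ split-unique)

      P₁Q : Walk P.start Q.start
      P₁Q = P₁ ++ʷ reverse Q.walk

      P₁-meets-Q : ∀ {v} → v ∈ verts P₁ → v ∈ verts (reverse Q.walk) → v ≡ Q.end
      P₁-meets-Q m₁ m₂ = Q.meets-Y-only-at-end (∈-reverse⁻ Q.walk m₂) (∈-++⁺ˡ (P₁⊆P m₁))

      meets-C : ∀ {v} → v ∈ verts P₁Q → v ∈ vertices C → v ≡ P.start ⊎ v ≡ Q.start
      meets-C m v∈C with ∈-++ʷ⁻ P₁ (reverse Q.walk) m
      ... | inj₁ m₁ = inj₁ (P.meets-X-only-at-start (P₁⊆P m₁) v∈C)
      ... | inj₂ m₂ = inj₂ (Q.meets-X-only-at-start (∈-reverse⁻ Q.walk m₂) v∈C)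

      R : Ear C P.start Q.start
      R = record
        { walk = P₁Q
        ; unique = Unique-++ʷ⁺ P₁ (reverse Q.walk) (proj₁ split-unique) (Unique-reverse Q.walk Q.unique) P₁-meets-Q
        ; start∈C = P.start∈X
        ; end∈C = Q.start∈X
        ; start≢end = c₁≢c₂
        ; meets-C-only-at-ends = meets-C
        ; 2≤len = subst (2 ≤_) (sym (trans (len-++ʷ P₁ _) (cong (len P₁ +_) (len-reverse Q.walk))))
                    (+-mono-≤ (len-pos P₁ (z≢c₁ ∘ sym)) (len-pos Q.walk c₂≢z))
        }

      P₁Q-off-D : ∀ {v} → v ∈ verts P₁Q → v ∉ vertices D
      P₁Q-off-D m v∈D with ∈-++ʷ⁻ P₁ (reverse Q.walk) m
      ... | inj₁ m₁ = z∉D (subst (_∈ vertices D) (P₁-meets-P₂ d₁∈P₁ (end∈verts P₂)) P.end∈Y)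
        where
        d₁∈P₁ : P.end ∈ verts P₁
        d₁∈P₁ = subst (_∈ verts P₁) (P.meets-Y-only-at-end (P₁⊆P m₁) v∈D) m₁
      ... | inj₂ m₂ = z∉D (subst (_∈ vertices D)
                             (Q.meets-Y-only-at-end (∈-reverse⁻ Q.walk m₂) (∈-++⁺ʳ (verts P.walk) v∈D)) v∈D)

      shorter : parity (len P₁Q) ≡ 0ℙ → Σ Configuration λ K′ → bridgeLength K′ < bridgeLength K
      shorter even with evenEar⇒oddCycle C C-odd R even
      ... | C′ , C′-odd , C′⊆C∪R , R⊆C′ = K′ , P₂<P
        where
        C′#D : Disjoint (vertices C′) (vertices D)
        C′#D (v∈C′ , v∈D) = [ (λ v∈C → C#D (v∈C , v∈D)) , (λ m → P₁Q-off-D m v∈D) ]′ (C′⊆C∪R v∈C′)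
        P₂-meets-C′ : ∀ {v} → v ∈ verts P₂ → v ∈ vertices C′ → v ≡ Q.end
        P₂-meets-C′ m v∈C′ with C′⊆C∪R v∈C′
        ... | inj₁ v∈C = trans v≡c₁ (P₁-meets-P₂ (here refl) (subst (_∈ verts P₂) v≡c₁ m))
          where
          v≡c₁ = P.meets-X-only-at-start (P₂⊆P m) v∈C
        ... | inj₂ m′ with ∈-++ʷ⁻ P₁ (reverse Q.walk) m′
        ...   | inj₁ m₁ = P₁-meets-P₂ m₁ m
        ...   | inj₂ m₂ = Q.meets-Y-only-at-end (∈-reverse⁻ Q.walk m₂) (∈-++⁺ˡ (P₂⊆P m))
        K′ : Configuration
        K′ = record
          { C = C′ ; D = D ; C-odd = C′-odd ; D-odd = D-odd ; C#D = C′#D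
          ; P = record
            { walk = P₂
            ; unique = proj₁ (proj₂ split-unique)
            ; start∈X = R⊆C′ (∈-++ʷ⁺ˡ P₁ (reverse Q.walk) (end∈verts P₁))
            ; end∈Y = P.end∈Y
            ; meets-X-only-at-start = P₂-meets-C′
            ; meets-Y-only-at-end = P.meets-Y-only-at-end ∘ P₂⊆P
            }
          }
        P₂<P : len P₂ < len P.walk
        P₂<P = subst (suc (len P₂) ≤_) (sym (trans (cong len P≡P₁++P₂) (len-++ʷ P₁ P₂)))
                 (+-monoˡ-≤ (len P₂) (len-pos P₁ (z≢c₁ ∘ sym)))

      outcome : HasSkewedTheta G ⊎ Σ Configuration λ K′ → bridgeLength K′ < bridgeLength K
      outcome with parity (len P₁Q) in eq
      ... | 1ℙ = inj₁ (oddEar⇒skewedTheta C C-odd R eq)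
      ... | 0ℙ = inj₂ (shorter eq)

    outcome : HasSkewedTheta G ⊎ Σ Configuration λ K′ → bridgeLength K′ < bridgeLength K
    outcome with Q.end ∈? vertices D
    ... | yes z∈D = inj₁ (uncurry (oddEar⇒skewedTheta C C-odd) (oddEarThroughD z∈D))
    ... | no z∉D = ThroughP.outcome z∉D

  skewedTheta-or-shorter : (K : Configuration) → HasSkewedTheta G ⊎ Σ Configuration λ K′ → bridgeLength K′ < bridgeLength K
  skewedTheta-or-shorter = Step.outcome

  Configuration⇒skewedTheta : (K : Configuration) → HasSkewedTheta G
  Configuration⇒skewedTheta K = go K (<-wellFounded (bridgeLength K))
    where
    go : (K : Configuration) → Acc _<_ (bridgeLength K) → HasSkewedTheta G
    go K (acc shorter) with skewedTheta-or-shorter K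
    ... | inj₁ θ = θ
    ... | inj₂ (K′ , K′<K) = go K′ (shorter K′<K)

open Cycles using (fromOddIsCycle; vertices; root∈vertices)
open Bridges using (bridgeOf)
open SubcubicCycles using (EdgeDisjoint⇒Disjoint)
open Configurations using (Configuration⇒skewedTheta)

lemma6 : (n : ℕ) (G : Graph n) → TwoConnected G → MaxDegreeAtMost G 3
    → HasTwoEdgeDisjointOddCycles G → HasSkewedTheta G
lemma6 n G 2-connected deg≤3 (C₀ , D₀ , C₀-cycle , D₀-cycle , C₀-odd , D₀-odd , C₀#D₀)
  with fromOddIsCycle G C₀-cycle C₀-odd | fromOddIsCycle G D₀-cycle D₀-odd
... | C , C-odd , C-edges | D , D-odd , D-edges =
  Configuration⇒skewedTheta G 2-connected deg≤3 record
    { C = C ; D = D ; C-odd = C-odd ; D-odd = D-odd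
    ; C#D = EdgeDisjoint⇒Disjoint G deg≤3 C D (λ u v e₁ e₂ → C₀#D₀ u v (C-edges e₁) (D-edges e₂))
    ; P = bridgeOf G (proj₁ (proj₂ 2-connected)) (vertices G C) (vertices G D) (root∈vertices G C) (root∈vertices G D)
    }
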